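{- Let $q,a,b\ge1$. (i) For any weak $(q+1)$-sum $(a,b)$-system $\mathcal{F}$ in $\{0,\dots,q\}^{<\mathbb{N}}$ there exists a weak $(q+1)$-sum $(a,b)$-system $\mathcal{F}'$ with $|\mathcal{F}'|=|\mathcal{F}|$ such that for every pair $(\mathbf{x}^j,\mathbf{y}^j)\in\mathcal{F}'$ and every coordinate $i$ with $x^j_i+y^j_i>0$ we have $x^j_i+y^j_i=q$. (ii) The same holds with "weak" replaced by "strong" throughout.
   Context: $\{0,\dots,q\}^{<\mathbb{N}}$ is the set of infinite sequences with entries in $\{0,\dots,q\}$ and finite support $S_{\mathbf{x}}=\{i:x_i\ne0\}$. For $\mathbf{x},\mathbf{y}$ put $|\mathbf{x}\cap_{q+1}\mathbf{y}|=|\{i:x_i+y_i\ge q+1\}|$. A system $\{(\mathbf{x}^j,\mathbf{y}^j):j=1,\dots,m\}$ with $|\mathbf{x}^j\cap_{q+1}\mathbf{y}^j|=0$ for all $j$ is a strong $(q+1)$-sum IVP-system if $|\mathbf{x}^i\cap_{q+1}\mathbf{y}^j|\ne0$ for all $i\ne j$, and weak if for all $i\ne j$ at least one of $|\mathbf{x}^i\cap_{q+1}\mathbf{y}^j|$, $|\mathbf{x}^j\cap_{q+1}\mathbf{y}^i|$ is nonzero. It is an $(a,b)$-system if $|S_{\mathbf{x}^j}|\le a$, $|S_{\mathbf{y}^j}|\le b$ for all $j$; its size is the number of pairs. -}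

module Defs where

open import Data.Nat using (ℕ; zero; suc; _+_; _≤_; _<_; _⊔_; _≟_; _≤?_)
open import Data.Fin using (Fin)
open import Data.Product using (Σ; _×_; _,_; proj₁; proj₂; ∃-syntax)
open import Relation.Nullary using (¬_; Dec; yes; no; ¬?)
open import Relation.Binary.PropositionalEquality using (_≡_; _≢_)

countBelow : (n : ℕ) (P : ℕ → Set) → ((i : ℕ) → Dec (P i)) → ℕ
countBelow zero    P P? = 0
countBelow (suc n) P P? with P? n
... | yes _ = suc (countBelow n P P?)
... | no  _ = countBelow n P P?

-- An element of {0,…,q}^{<ℕ}: an infinite sequence ℕ → ℕ with entries ≤ q
-- and finite support, witnessed by a bound N beyond which all entries are 0.
record Seq (q : ℕ) : Set where
  constructor mkSeq
  field
    val     : ℕ → ℕ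
    bounded : ∀ i → val i ≤ q
    bound   : ℕ
    vanish  : ∀ i → bound ≤ i → val i ≡ 0
open Seq public

-- |S_x| : the number of nonzero coordinates (all of which lie below the bound)
supportSize : ∀ {q} → Seq q → ℕ
supportSize x = countBelow (bound x) (λ i → val x i ≢ 0) (λ i → ¬? (val x i ≟ 0))

-- |x ∩_{q+1} y| = |{ i : x_i + y_i ≥ q+1 }|  (all such i lie below both bounds' max)
capSize : ∀ {q} → Seq q → Seq q → ℕ
capSize {q} x y =
  countBelow (bound x ⊔ bound y) (λ i → suc q ≤ val x i + val y i)
             (λ i → suc q ≤? val x i + val y i)

System : ℕ → ℕ → Set
System q m = Fin m → Seq q × Seq q

xs : ∀ {q m} → System q m → Fin m → Seq q
xs F j = proj₁ (F j)

ys : ∀ {q m} → System q m → Fin m → Seq q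
ys F j = proj₂ (F j)

Diagonal : ∀ {q m} → System q m → Set
Diagonal F = ∀ j → capSize (xs F j) (ys F j) ≡ 0

StrongIVP : ∀ {q m} → System q m → Set
StrongIVP F = Diagonal F × (∀ i j → i ≢ j → capSize (xs F i) (ys F j) ≢ 0)

WeakIVP : ∀ {q m} → System q m → Set
WeakIVP F = Diagonal F ×
  (∀ i j → i ≢ j → ¬ (capSize (xs F i) (ys F j) ≡ 0 × capSize (xs F j) (ys F i) ≡ 0))

IsAB : ∀ {q m} → ℕ → ℕ → System q m → Set
IsAB a b F = ∀ j → supportSize (xs F j) ≤ a × supportSize (ys F j) ≤ b

SumsToQ : ∀ {q m} → System q m → Set
SumsToQ {q} F = ∀ j i → 0 < val (xs F j) i + val (ys F j) i →
                 val (xs F j) i + val (ys F j) i ≡ q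

{-# OPTIONS --safe #-}
-- Saturate every pair (x, y) coordinatewise: on a coordinate where exactly one
-- of x_i, y_i is nonzero raise it to q, and where both are nonzero raise y_i to
-- q − x_i.  Since |x ∩_{q+1} y| = 0 means x_i + y_i ≤ q everywhere, this only
-- increases entries, keeps every support and makes every nonzero x_i + y_i equal
-- to q.  The new diagonal pairs are still disjoint, and as |x ∩_{q+1} y| is
-- monotone in both arguments every cross intersection can only grow, so both
-- the weak and the strong IVP-property are preserved.
module Submission where

open import Defs
open import Data.Nat using (ℕ; zero; suc; _+_; _∸_; _≤_; _<_; _⊔_; _<?_; z≤n; s≤s)
open import Data.Nat.Properties
open import Data.Product using (_×_; Σ; _,_; proj₁; proj₂)
open import Data.Sum using (inj₁; inj₂)
open import Data.Empty using (⊥-elim)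
open import Relation.Nullary using (¬_; yes; no)
open import Relation.Binary.PropositionalEquality

countBelow-mono : ∀ n {P Q : ℕ → Set} P? Q? → (∀ i → P i → Q i) →
                  countBelow n P P? ≤ countBelow n Q Q?
countBelow-mono zero    P? Q? P⇒Q = z≤n
countBelow-mono (suc n) P? Q? P⇒Q with P? n | Q? n
... | yes _  | yes _  = s≤s (countBelow-mono n P? Q? P⇒Q)
... | yes p  | no ¬q  = ⊥-elim (¬q (P⇒Q n p))
... | no _   | yes _  = m≤n⇒m≤1+n (countBelow-mono n P? Q? P⇒Q)
... | no _   | no _   = countBelow-mono n P? Q? P⇒Q

countBelow-cong : ∀ n {P Q : ℕ → Set} P? Q? → (∀ i → P i → Q i) → (∀ i → Q i → P i) →
                  countBelow n P P? ≡ countBelow n Q Q?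
countBelow-cong n P? Q? P⇒Q Q⇒P =
  ≤-antisym (countBelow-mono n P? Q? P⇒Q) (countBelow-mono n Q? P? Q⇒P)

countBelow-none : ∀ n {P : ℕ → Set} P? → (∀ i → ¬ P i) → countBelow n P P? ≡ 0
countBelow-none zero    P? ¬P = refl
countBelow-none (suc n) P? ¬P with P? n
... | yes p = ⊥-elim (¬P n p)
... | no _  = countBelow-none n P? ¬P

countBelow≡0⇒¬ : ∀ n {P : ℕ → Set} P? → countBelow n P P? ≡ 0 → ∀ i → i < n → ¬ P i
countBelow≡0⇒¬ (suc n) P? count≡0 i i<1+n p with P? n | m<1+n⇒m<n∨m≡n i<1+n
countBelow≡0⇒¬ (suc n) P? ()      i i<1+n p | yes _ | _
... | no _  | inj₁ i<n  = countBelow≡0⇒¬ n P? count≡0 i i<n p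
... | no ¬p | inj₂ refl = ¬p p

capSize≡0⇒+≤ : ∀ {q} (x y : Seq q) → capSize x y ≡ 0 → ∀ i → val x i + val y i ≤ q
capSize≡0⇒+≤ x y cap≡0 i with i <? bound x ⊔ bound y
... | yes i<bound = ≮⇒≥ (countBelow≡0⇒¬ _ _ cap≡0 i i<bound)
... | no  i≮bound
  rewrite vanish x i (≤-trans (m≤m⊔n _ _) (≮⇒≥ i≮bound))
        | vanish y i (≤-trans (m≤n⊔m _ _) (≮⇒≥ i≮bound)) = z≤n

capSize-mono : ∀ {q} (x y x′ y′ : Seq q) → bound x ≡ bound x′ → bound y ≡ bound y′ →
               (∀ i → val x i ≤ val x′ i) → (∀ i → val y i ≤ val y′ i) →
               capSize x y ≤ capSize x′ y′
capSize-mono x y x′ y′ refl refl x≤x′ y≤y′ =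
  countBelow-mono (bound x′ ⊔ bound y′) _ _
    (λ i q<x+y → ≤-trans q<x+y (+-mono-≤ (x≤x′ i) (y≤y′ i)))

supportSize-cong : ∀ {q} (x x′ : Seq q) → bound x ≡ bound x′ →
                   (∀ i → val x i ≡ 0 → val x′ i ≡ 0) →
                   (∀ i → val x′ i ≡ 0 → val x i ≡ 0) →
                   supportSize x ≡ supportSize x′
supportSize-cong x x′ refl x≡0⇒ x′≡0⇒ =
  countBelow-cong (bound x′) _ _ (λ i x≢0 x′≡0 → x≢0 (x′≡0⇒ i x′≡0))
                                 (λ i x′≢0 x≡0 → x′≢0 (x≡0⇒ i x≡0))

raiseˡ : ℕ → ℕ → ℕ → ℕ
raiseˡ q zero    b       = zero
raiseˡ q (suc k) zero    = q
raiseˡ q (suc k) (suc l) = suc k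

raiseʳ : ℕ → ℕ → ℕ → ℕ
raiseʳ q a zero    = zero
raiseʳ q a (suc l) = q ∸ a

raiseˡ-≤ : ∀ {q a} b → a ≤ q → raiseˡ q a b ≤ q
raiseˡ-≤ {a = zero}  b       a≤q = z≤n
raiseˡ-≤ {a = suc k} zero    a≤q = ≤-refl
raiseˡ-≤ {a = suc k} (suc l) a≤q = a≤q

raiseʳ-≤ : ∀ q a b → raiseʳ q a b ≤ q
raiseʳ-≤ q a zero    = z≤n
raiseʳ-≤ q a (suc l) = m∸n≤m q a

≤-raiseˡ : ∀ {q a} b → a ≤ q → a ≤ raiseˡ q a b
≤-raiseˡ {a = zero}  b       a≤q = z≤n
≤-raiseˡ {a = suc k} zero    a≤q = a≤q
≤-raiseˡ {a = suc k} (suc l) a≤q = ≤-refl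

≤-raiseʳ : ∀ {q} a b → a + b ≤ q → b ≤ raiseʳ q a b
≤-raiseʳ a zero    a+b≤q = z≤n
≤-raiseʳ a (suc l) a+b≤q = m+n≤o⇒m≤o∸n (suc l)
  (≤-trans (≤-reflexive (+-comm (suc l) a)) a+b≤q)

raiseˡ≡0⇒ : ∀ {q a} b → a ≤ q → raiseˡ q a b ≡ 0 → a ≡ 0
raiseˡ≡0⇒ {a = zero}  b       a≤q ≡0 = refl
raiseˡ≡0⇒ {a = suc k} zero    a≤q refl with () ← a≤q
raiseˡ≡0⇒ {a = suc k} (suc l) a≤q ()

raiseʳ≡0⇒ : ∀ {q} a b → a + b ≤ q → raiseʳ q a b ≡ 0 → b ≡ 0
raiseʳ≡0⇒ a zero    a+b≤q ≡0 = refl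
raiseʳ≡0⇒ a (suc l) a+b≤q ≡0 with () ← subst (suc l ≤_) ≡0 (≤-raiseʳ a (suc l) a+b≤q)

raise-+ : ∀ {q} a b → a + b ≤ q →
          0 < raiseˡ q a b + raiseʳ q a b → raiseˡ q a b + raiseʳ q a b ≡ q
raise-+ zero    zero    a+b≤q ()
raise-+ zero    (suc l) a+b≤q _ = refl
raise-+ (suc k) zero    a+b≤q _ = +-identityʳ _
raise-+ (suc k) (suc l) a+b≤q _ = m+[n∸m]≡n (≤-trans (m≤m+n (suc k) (suc l)) a+b≤q)

raise-+-≤ : ∀ {q} a b → a + b ≤ q → raiseˡ q a b + raiseʳ q a b ≤ q
raise-+-≤ zero    zero    a+b≤q = z≤n
raise-+-≤ zero    (suc l) a+b≤q = ≤-refl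
raise-+-≤ (suc k) zero    a+b≤q = ≤-reflexive (+-identityʳ _)
raise-+-≤ (suc k) (suc l) a+b≤q = ≤-reflexive (raise-+ (suc k) (suc l) a+b≤q (s≤s z≤n))

saturateˡ : ∀ {q} → Seq q → Seq q → Seq q
saturateˡ {q} x y = mkSeq (λ i → raiseˡ q (val x i) (val y i))
                          (λ i → raiseˡ-≤ (val y i) (bounded x i))
                          (bound x)
                          (λ i i≥bound → cong (λ a → raiseˡ q a (val y i)) (vanish x i i≥bound))

saturateʳ : ∀ {q} → Seq q → Seq q → Seq q
saturateʳ {q} x y = mkSeq (λ i → raiseʳ q (val x i) (val y i))
                          (λ i → raiseʳ-≤ q (val x i) (val y i))
                          (bound y)
                          (λ i i≥bound → cong (raiseʳ q (val x i)) (vanish y i i≥bound))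

saturate : ∀ {q m} → System q m → System q m
saturate F j = saturateˡ (xs F j) (ys F j) , saturateʳ (xs F j) (ys F j)

module _ {q m} (F : System q m) (diagonal : Diagonal F) where

  private
    +≤q : ∀ j i → val (xs F j) i + val (ys F j) i ≤ q
    +≤q j = capSize≡0⇒+≤ (xs F j) (ys F j) (diagonal j)

  saturate-diagonal : Diagonal (saturate F)
  saturate-diagonal j = countBelow-none (bound (xs F j) ⊔ bound (ys F j)) _
    (λ i q<sum → <⇒≱ q<sum (raise-+-≤ (val (xs F j) i) (val (ys F j) i) (+≤q j i)))

  saturate-sumsToQ : SumsToQ (saturate F)
  saturate-sumsToQ j i = raise-+ (val (xs F j) i) (val (ys F j) i) (+≤q j i)

  saturate-isAB : ∀ {a b} → IsAB a b F → IsAB a b (saturate F)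
  saturate-isAB {a} {b} ab j =
    subst (_≤ a) (supportSize-cong x (saturateˡ x y) refl
      (λ i x≡0 → cong (λ a → raiseˡ q a (val y i)) x≡0)
      (λ i → raiseˡ≡0⇒ (val y i) (bounded x i))) (proj₁ (ab j)) ,
    subst (_≤ b) (supportSize-cong y (saturateʳ x y) refl
      (λ i y≡0 → cong (raiseʳ q (val x i)) y≡0)
      (λ i → raiseʳ≡0⇒ (val x i) (val y i) (+≤q j i))) (proj₂ (ab j))
    where
    x = xs F j
    y = ys F j

  capSize-saturate : ∀ i j → capSize (xs F i) (ys F j) ≤
                             capSize (xs (saturate F) i) (ys (saturate F) j)
  capSize-saturate i j =
    capSize-mono (xs F i) (ys F j) (xs (saturate F) i) (ys (saturate F) j) refl refl
    (λ k → ≤-raiseˡ (val (ys F i) k) (bounded (xs F i) k))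
    (λ k → ≤-raiseʳ (val (xs F j) k) (val (ys F j) k) (+≤q j k))

  capSize-saturate≡0 : ∀ i j → capSize (xs (saturate F) i) (ys (saturate F) j) ≡ 0 →
                       capSize (xs F i) (ys F j) ≡ 0
  capSize-saturate≡0 i j cap≡0 = n≤0⇒n≡0 (≤-trans (capSize-saturate i j) (≤-reflexive cap≡0))

saturate-weakIVP : ∀ {q m} (F : System q m) → WeakIVP F → WeakIVP (saturate F)
saturate-weakIVP F (diagonal , weak) =
  saturate-diagonal F diagonal ,
  λ i j i≢j (capᵢⱼ≡0 , capⱼᵢ≡0) →
    weak i j i≢j ( capSize-saturate≡0 F diagonal i j capᵢⱼ≡0
                 , capSize-saturate≡0 F diagonal j i capⱼᵢ≡0)

saturate-strongIVP : ∀ {q m} (F : System q m) → StrongIVP F → StrongIVP (saturate F)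
saturate-strongIVP F (diagonal , strong) =
  saturate-diagonal F diagonal ,
  λ i j i≢j capᵢⱼ≡0 → strong i j i≢j (capSize-saturate≡0 F diagonal i j capᵢⱼ≡0)

mainTheorem11 : (q a b : ℕ) → 1 ≤ q → 1 ≤ a → 1 ≤ b →
    ((m : ℕ) (F : System q m) → WeakIVP F → IsAB a b F →
      Σ (System q m) (λ F′ → WeakIVP F′ × IsAB a b F′ × SumsToQ F′))
    ×
    ((m : ℕ) (F : System q m) → StrongIVP F → IsAB a b F →
      Σ (System q m) (λ F′ → StrongIVP F′ × IsAB a b F′ × SumsToQ F′))
mainTheorem11 q a b _ _ _ = weak , strong
  where
  weak : (m : ℕ) (F : System q m) → WeakIVP F → IsAB a b F →
         Σ (System q m) (λ F′ → WeakIVP F′ × IsAB a b F′ × SumsToQ F′)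
  weak m F ivp ab = saturate F , saturate-weakIVP F ivp ,
    saturate-isAB F (proj₁ ivp) ab , saturate-sumsToQ F (proj₁ ivp)

  strong : (m : ℕ) (F : System q m) → StrongIVP F → IsAB a b F →
           Σ (System q m) (λ F′ → StrongIVP F′ × IsAB a b F′ × SumsToQ F′)
  strong m F ivp ab = saturate F , saturate-strongIVP F ivp ,
    saturate-isAB F (proj₁ ivp) ab , saturate-sumsToQ F (proj₁ ivp)
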